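{- Let $\mathcal{F}=\langle X,R^+,R^-\rangle$ be a collectively connected symmetric signed frame. Then $\mathcal{F}$ has the local weak balance property if and only if $R^+$ is a collusion.
   Context: A symmetric signed frame is a tuple $\langle X,R^+,R^-\rangle$ with $X$ a set and $R^+,R^-\subseteq X\times X$ such that: $R^+$ is reflexive and symmetric; $R^-$ is symmetric; and $\forall x,y\in X.\ \neg(xR^+y)\vee\neg(xR^-y)$. It is collectively connected if moreover $\forall x,y\in X.\ (xR^+y \vee xR^-y)$. It has the local weak balance property iff for all $x,y,z\in X$: (1) $(xR^+y\wedge yR^+z)\Rightarrow xR^+z$, and (2) $((xR^+y\wedge yR^-z)\vee(xR^-y\wedge yR^+z))\Rightarrow xR^-z$. A relation $S$ on $X$ is collusive iff $\forall x,y,z,w\in X\,\big((xSy\wedge xSz\wedge wSy)\Rightarrow wSz\big)$; it is a collusion iff it is collusive, total ($\forall x\exists y.\ xSy$) and surjective ($\forall x\exists y.\ ySx$). -}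

module Defs where

open import Level using (Level; _⊔_; suc)
open import Data.Product using (_×_; ∃)
open import Data.Sum using (_⊎_)
open import Relation.Nullary using (¬_)
open import Relation.Binary.Core using (Rel)
open import Relation.Binary.Definitions using (Reflexive; Symmetric)
open import Function.Bundles using (_⇔_)

record SymmetricSignedFrame (a ℓ : Level) : Set (suc (a ⊔ ℓ)) where
  field
    X       : Set a
    R⁺      : Rel X ℓ
    R⁻      : Rel X ℓ
    R⁺-refl : Reflexive R⁺
    R⁺-sym  : Symmetric R⁺
    R⁻-sym  : Symmetric R⁻
    disjoint : ∀ x y → ¬ R⁺ x y ⊎ ¬ R⁻ x y

module _ {a ℓ : Level} (F : SymmetricSignedFrame a ℓ) where
  open SymmetricSignedFrame F

  CollectivelyConnected : Set (a ⊔ ℓ)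
  CollectivelyConnected = ∀ x y → R⁺ x y ⊎ R⁻ x y

  LocalWeakBalance : Set (a ⊔ ℓ)
  LocalWeakBalance =
    (∀ x y z → R⁺ x y × R⁺ y z → R⁺ x z) ×
    (∀ x y z → (R⁺ x y × R⁻ y z) ⊎ (R⁻ x y × R⁺ y z) → R⁻ x z)

module _ {a ℓ : Level} {A : Set a} where

  Collusive : Rel A ℓ → Set (a ⊔ ℓ)
  Collusive S = ∀ x y z w → S x y × S x z × S w y → S w z

  Total : Rel A ℓ → Set (a ⊔ ℓ)
  Total S = ∀ x → ∃ λ y → S x y

  Surjective : Rel A ℓ → Set (a ⊔ ℓ)
  Surjective S = ∀ x → ∃ λ y → S y x

  Collusion : Rel A ℓ → Set (a ⊔ ℓ)
  Collusion S = Collusive S × Total S × Surjective S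

module Submission where

open import Defs
open import Level using (Level)
open import Function.Bundles using (_⇔_; mk⇔)
open import Data.Product using (_×_; _,_)
open import Data.Sum using (_⊎_; inj₁; inj₂)
open import Relation.Nullary using (¬_; contradiction)
open import Relation.Binary.Core using (Rel)
open import Relation.Binary.Definitions using (Reflexive; Symmetric; Transitive)

-- For a reflexive symmetric relation, being a collusion is just being transitive;
-- the negative clause of local weak balance then comes for free from collective
-- connectedness: if x R⁻-relates to neither side, x and z are R⁺-related, and
-- transitivity would put an R⁺ edge on top of an R⁻ edge.

module _ {a ℓ : Level} {A : Set a} {S : Rel A ℓ} where

  reflexive⇒total : Reflexive S → Total S
  reflexive⇒total refl x = x , refl

  reflexive⇒surjective : Reflexive S → Surjective S
  reflexive⇒surjective refl x = x , refl

  transitive⇒collusive : Symmetric S → Transitive S → Collusive S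
  transitive⇒collusive sym trans x y z w (xSy , xSz , wSy) =
    trans (trans wSy (sym xSy)) xSz

  collusive⇒transitive : Reflexive S → Symmetric S → Collusive S → Transitive S
  collusive⇒transitive refl sym col {x} {y} {z} xSy ySz =
    col y x z x (sym xSy , ySz , refl)

module _ {a ℓ : Level} (F : SymmetricSignedFrame a ℓ) where
  open SymmetricSignedFrame F

  R⁺⇒¬R⁻ : ∀ {x y} → R⁺ x y → ¬ R⁻ x y
  R⁺⇒¬R⁻ {x} {y} xy⁺ with disjoint x y
  ... | inj₁ ¬xy⁺ = contradiction xy⁺ ¬xy⁺
  ... | inj₂ ¬xy⁻ = ¬xy⁻

  R⁺-transitive⇒R⁻-balanced : CollectivelyConnected F → Transitive R⁺ →
    ∀ x y z → (R⁺ x y × R⁻ y z) ⊎ (R⁻ x y × R⁺ y z) → R⁻ x z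
  R⁺-transitive⇒R⁻-balanced connected trans x y z h with connected x z
  ... | inj₂ xz⁻ = xz⁻
  R⁺-transitive⇒R⁻-balanced connected trans x y z (inj₁ (xy⁺ , yz⁻)) | inj₁ xz⁺ =
    contradiction yz⁻ (R⁺⇒¬R⁻ (trans (R⁺-sym xy⁺) xz⁺))
  R⁺-transitive⇒R⁻-balanced connected trans x y z (inj₂ (xy⁻ , yz⁺)) | inj₁ xz⁺ =
    contradiction xy⁻ (R⁺⇒¬R⁻ (trans xz⁺ (R⁺-sym yz⁺)))

mainTheorem10 : {a ℓ : Level} (F : SymmetricSignedFrame a ℓ) →
    CollectivelyConnected F →
    (LocalWeakBalance F ⇔ Collusion (SymmetricSignedFrame.R⁺ F))
mainTheorem10 F connected = mk⇔ to from
  where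
  open SymmetricSignedFrame F

  to : LocalWeakBalance F → Collusion R⁺
  to (positive , _) =
    transitive⇒collusive R⁺-sym (λ {x} {y} {z} xy yz → positive x y z (xy , yz))
    , reflexive⇒total R⁺-refl
    , reflexive⇒surjective R⁺-refl

  from : Collusion R⁺ → LocalWeakBalance F
  from (collusive , _) =
    (λ x y z (xy , yz) → trans xy yz) , R⁺-transitive⇒R⁻-balanced F connected trans
    where
    trans : Transitive R⁺
    trans = collusive⇒transitive R⁺-refl R⁺-sym collusive
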